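{- Let $H$ be a reflexive digraph. The 2CNF formula $\phi_H$ is satisfiable if and only if $H$ has no invertible pairs.
   Context: Digraphs are finite, without multiple edges, possibly with loops; reflexive means every vertex has a loop. The formula $\phi_H$: fix a linear order of $V(H)$; for each pair $u,v$ with $u$ preceding $v$ introduce a Boolean variable $x_{(u,v)}$, and write $x_{(v,u)}$ for its negation. Then $\phi_H$ is the conjunction of all clauses $(x_{(u,v)} \vee x_{(v,w)})$ over distinct vertices $u,v,w$ of $H$ such that either ($(u,w) \in E(H)$ and $(u,v) \notin E(H)$) or ($(w,u) \in E(H)$ and $(v,u) \notin E(H)$). The pair digraph $H^+$ has vertex set $\{(u,v) : u,v \in V(H),\ u\neq v\}$, and for vertices $u,u',v,v'$ of $H$ we have edges $(u,u') \to (v,v')$ and $(v',v) \to (u',u)$ in $H^+$ if and only if $(u,v),(u',v') \in E(H)$ and $(u,v') \notin E(H)$. An invertible pair of $H$ is a pair of distinct vertices $u,v$ such that $(u,v)$ and $(v,u)$ lie in the same strong component of $H^+$. -}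

module Defs where

open import Data.Nat using (ℕ)
open import Data.Fin using (Fin; _<_)
open import Data.Bool using (Bool; true; false; not)
open import Data.Product using (_×_; Σ; ∃; _,_)
open import Data.Sum using (_⊎_)
open import Relation.Nullary using (¬_; yes; no)
open import Relation.Binary.PropositionalEquality using (_≡_; _≢_)
open import Relation.Binary.Construct.Closure.ReflexiveTransitive using (Star)
open import Data.Fin.Properties using (_<?_)

record Digraph : Set where
  field
    n : ℕ
    E : Fin n → Fin n → Bool

open Digraph public

V : Digraph → Set
V H = Fin (n H)

Edge : (H : Digraph) → V H → V H → Set
Edge H u v = E H u v ≡ true

Reflexive : Digraph → Set
Reflexive H = ∀ (v : V H) → Edge H v v

-- Truth assignments to the variables x_(u,v), u < v (linear order of Fin n).
-- An assignment is a function σ; only its values σ u v with u < v are used.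
Assignment : Digraph → Set
Assignment H = V H → V H → Bool

lit : (H : Digraph) → Assignment H → V H → V H → Bool
lit H σ u v with u <? v
... | yes _ = σ u v
... | no  _ = not (σ v u)

-- condition under which the clause (x_(u,v) ∨ x_(v,w)) is in φ_H
ClauseIn : (H : Digraph) → V H → V H → V H → Set
ClauseIn H u v w =
  u ≢ v × v ≢ w × u ≢ w ×
  ((Edge H u w × ¬ Edge H u v) ⊎ (Edge H w u × ¬ Edge H v u))

Satisfies : (H : Digraph) → Assignment H → Set
Satisfies H σ = ∀ (u v w : V H) → ClauseIn H u v w →
  (lit H σ u v ≡ true) ⊎ (lit H σ v w ≡ true)

Satisfiable : Digraph → Set
Satisfiable H = Σ (Assignment H) (Satisfies H)

BaseEdge : (H : Digraph) → V H → V H → V H → V H → Set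
BaseEdge H u u' v v' = Edge H u v × Edge H u' v' × ¬ Edge H u v'

-- Edge of H⁺ from (a,b) to (c,d): either (a,b)→(c,d) is a base edge, or it is
-- the reversed copy (v',v)→(u',u) of a base edge (u,u')→(v,v') (u=d,u'=c,v=b,v'=a).
PlusEdge : (H : Digraph) → V H × V H → V H × V H → Set
PlusEdge H (a , b) (c , d) =
  a ≢ b × c ≢ d × (BaseEdge H a b c d ⊎ BaseEdge H d c b a)

Reach : (H : Digraph) → V H × V H → V H × V H → Set
Reach H = Star (PlusEdge H)

InvertiblePair : (H : Digraph) → V H → V H → Set
InvertiblePair H u v =
  u ≢ v × Reach H (u , v) (v , u)
        × Reach H (v , u) (u , v)

HasInvertiblePair : Digraph → Set
HasInvertiblePair H = ∃ λ u → ∃ λ v → InvertiblePair H u v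

-- Read the literal x_(u,v) as a truth value attached to the ordered pair
-- (u,v), the reversed pair (v,u) carrying the opposite value.
--
-- (⇒) A satisfying assignment makes the truth of pairs "pull back" along H⁺:
--     if (a,b) → (c,d) is an edge of H⁺ and (c,d) is true, so is (a,b).  For a
--     base edge this follows from two clauses of φ_H passing through (a,d); for
--     a reversed edge from antisymmetry.  Walks (u,v) ⇝ (v,u) ⇝ (u,v) would then
--     force (u,v) and (v,u) to have the same value, which is impossible.
-- (⇐) By reflexivity every clause (x_(u,v) ∨ x_(v,w)) is witnessed by an edge
--     (u,v) → (w,v) of H⁺.  So it suffices to find a set of pairs closed
--     backwards along H⁺, never containing a pair and its reverse, and
--     containing (u,v) or (v,u) for all u ≠ v.  It is built greedily, adding a
--     pair with everything reaching it; skew-symmetry of H⁺ and the absence of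
--     invertible pairs keep it consistent.
module Submission where

open import Defs
open import Data.Product using (_×_; Σ; ∃₂; _,_; proj₁; proj₂; swap)
open import Data.Product.Properties using (≡-dec)
open import Data.Sum using (_⊎_; inj₁; inj₂)
open import Data.Empty using (⊥; ⊥-elim)
open import Function using (_∘_)
open import Data.Nat using (ℕ; suc; _+_; _≤_; _<_; z≤n; s≤s)
open import Data.Nat.Properties using (≤-refl; n<1+n; <-≤-trans; +-mono-≤; +-mono-<-≤; +-mono-≤-<)
open import Data.Bool using (Bool; true; false; not; _∨_; if_then_else_)
open import Data.Bool.Properties using (not-involutive) renaming (_≟_ to _≟ᵇ_)
open import Data.List using (List; []; _∷_; allFin; cartesianProduct)
open import Data.List.Relation.Unary.Any using (here; there; any?; satisfied)
open import Data.List.Membership.Propositional using (_∈_; lose)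
open import Data.List.Membership.Propositional.Properties using (∈-allFin; ∈-cartesianProduct⁺)
open import Data.Fin.Properties using (_<?_; <-asym; <-cmp) renaming (_≟_ to _≟ᶠ_)
open import Relation.Nullary using (¬_; Dec; yes; no; does)
open import Relation.Nullary.Decidable using (dec-true; _×-dec_; _⊎-dec_; ¬?)
open import Relation.Binary.Definitions using (DecidableEquality; tri<; tri≈; tri>)
open import Relation.Binary.PropositionalEquality using (_≡_; _≢_; refl; sym; trans; cong; ≢-sym)
open import Relation.Binary.Construct.Closure.ReflexiveTransitive using (Star; ε; _◅_; _◅◅_)

true≢false : ∀ {b} → b ≡ true → b ≡ false → ⊥
true≢false refl ()

∨-true : ∀ x y → x ∨ y ≡ true → x ≡ true ⊎ y ≡ true
∨-true true  _ _ = inj₁ refl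
∨-true false _ e = inj₂ e

∨-introˡ : ∀ {x} y → x ≡ true → x ∨ y ≡ true
∨-introˡ _ refl = refl

∨-introʳ : ∀ x {y} → y ≡ true → x ∨ y ≡ true
∨-introʳ true  _ = refl
∨-introʳ false e = e

does-sound : ∀ {P : Set} (d : Dec P) → does d ≡ true → P
does-sound (yes p) _ = p

Subset : Set → Set
Subset L = L → Bool

_⊆_ : ∀ {L} → Subset L → Subset L → Set
S ⊆ S' = ∀ x → S x ≡ true → S' x ≡ true

⊆-refl : ∀ {L} {S : Subset L} → S ⊆ S
⊆-refl _ Sx = Sx

-- The set of elements
-- reachable from z is computed by repeatedly adding the target of an R-edge
-- leaving the current set; the number of listed elements outside the set
-- decreases, so the process stops at a set that is closed under R.
module Reachability {L : Set} (_≟_ : DecidableEquality L)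
                    (elements : List L) (complete : ∀ x → x ∈ elements)
                    (R : L → L → Set) (R? : ∀ x y → Dec (R x y)) where

  -- termination measure: how many entries of a list lie outside S
  outside : Bool → ℕ
  outside b = if b then 0 else 1

  missing : Subset L → List L → ℕ
  missing S []       = 0
  missing S (x ∷ xs) = outside (S x) + missing S xs

  outside-anti : ∀ {b b'} → (b ≡ true → b' ≡ true) → outside b' ≤ outside b
  outside-anti {true}  {true}  _ = ≤-refl
  outside-anti {true}  {false} h with h refl
  ... | ()
  outside-anti {false} {true}  _ = z≤n
  outside-anti {false} {false} _ = ≤-refl

  missing-anti : ∀ {S S'} → S ⊆ S' → ∀ xs → missing S' xs ≤ missing S xs
  missing-anti sub []       = z≤n
  missing-anti sub (x ∷ xs) = +-mono-≤ (outside-anti (sub x)) (missing-anti sub xs)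

  missing-strict : ∀ {S S' x xs} → S ⊆ S' → x ∈ xs → S x ≡ false → S' x ≡ true →
                   missing S' xs < missing S xs
  missing-strict {xs = _ ∷ xs} sub (here refl) Sx S'x =
    +-mono-<-≤ (strict Sx S'x) (missing-anti sub xs)
    where
    strict : ∀ {b b'} → b ≡ false → b' ≡ true → outside b' < outside b
    strict refl refl = s≤s z≤n
  missing-strict {xs = y ∷ _} sub (there x∈xs) Sx S'x =
    +-mono-≤-< (outside-anti (sub y)) (missing-strict sub x∈xs Sx S'x)

  Closed : Subset L → Set
  Closed S = ∀ x y → S x ≡ true → R x y → S y ≡ true

  closed-star : ∀ {S} → Closed S → ∀ {x y} → Star R x y → S x ≡ true → S y ≡ true
  closed-star closed ε        Sx = Sx
  closed-star closed (r ◅ rs) Sx = closed-star closed rs (closed _ _ Sx r)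

  Escape : Subset L → Set
  Escape S = ∃₂ λ y x → S y ≡ true × S x ≡ false × R y x

  escape? : ∀ S → Escape S ⊎ Closed S
  escape? S with any? (λ y → any? (λ x → (S y ≟ᵇ true) ×-dec ((S x ≟ᵇ false) ×-dec R? y x))
                                  elements) elements
  ... | yes found with satisfied found
  ...   | y , found-x with satisfied found-x
  ...     | x , Sy , Sx , Ryx = inj₁ (y , x , Sy , Sx , Ryx)
  escape? S | no none = inj₂ closed
    where
    closed : Closed S
    closed y x Sy Ryx with S x in Sx
    ... | true  = refl
    ... | false = ⊥-elim (none (lose (complete y) (lose (complete x) (Sy , Sx , Ryx))))

  Reached : L → Subset L → Set
  Reached z S = ∀ x → S x ≡ true → Star R z x

  insert : Subset L → L → Subset L
  insert S x w = S w ∨ does (w ≟ x)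

  insert-⊇ : ∀ S x → S ⊆ insert S x
  insert-⊇ S x w Sw = ∨-introˡ (does (w ≟ x)) Sw

  insert-new : ∀ S x → insert S x x ≡ true
  insert-new S x = ∨-introʳ (S x) (dec-true (x ≟ x) refl)

  insert-reached : ∀ {z S y x} → Reached z S → S y ≡ true → R y x → Reached z (insert S x)
  insert-reached {S = S} {x = x} reached Sy Ryx w w∈ with ∨-true (S w) (does (w ≟ x)) w∈
  ... | inj₁ Sw  = reached w Sw
  ... | inj₂ w≡x with does-sound (w ≟ x) w≡x
  ...   | refl = reached _ Sy ◅◅ (Ryx ◅ ε)

  Saturation : L → Set
  Saturation z = Σ (Subset L) λ T → T z ≡ true × Reached z T × Closed T

  saturate : ∀ fuel S z → missing S elements < fuel → S z ≡ true → Reached z S → Saturation z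
  saturate (suc fuel) S z (s≤s bound) Sz reached with escape? S
  ... | inj₂ closed = S , Sz , reached , closed
  ... | inj₁ (y , x , Sy , Sx , Ryx) =
    saturate fuel (insert S x) z
      (<-≤-trans (missing-strict (insert-⊇ S x) (complete x) Sx (insert-new S x)) bound)
      (insert-⊇ S x z Sz) (insert-reached reached Sy Ryx)

  singleton : L → Subset L
  singleton z w = does (w ≟ z)

  singleton-reached : ∀ z → Reached z (singleton z)
  singleton-reached z w w≡z with does-sound (w ≟ z) w≡z
  ... | refl = ε

  reach? : ∀ z y → Dec (Star R z y)
  reach? z y with saturate (suc (missing (singleton z) elements)) (singleton z) z (n<1+n _)
                           (dec-true (z ≟ z) refl) (singleton-reached z)
  ... | T , Tz , reached , closed with T y in Ty
  ...   | true  = yes (reached y Ty)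
  ...   | false = no λ z⇝y → true≢false (closed-star closed z⇝y Tz) Ty

module PairDigraph (H : Digraph) where

  Pair : Set
  Pair = V H × V H

  allPairs : List Pair
  allPairs = cartesianProduct (allFin (n H)) (allFin (n H))

  allPairs-complete : ∀ p → p ∈ allPairs
  allPairs-complete (a , b) = ∈-cartesianProduct⁺ (∈-allFin a) (∈-allFin b)

  edge? : ∀ u v → Dec (Edge H u v)
  edge? u v = E H u v ≟ᵇ true

  baseEdge? : ∀ a b c d → Dec (BaseEdge H a b c d)
  baseEdge? a b c d = edge? a c ×-dec (edge? b d ×-dec ¬? (edge? a d))

  plusEdge? : ∀ p q → Dec (PlusEdge H p q)
  plusEdge? (a , b) (c , d) =
    ¬? (a ≟ᶠ b) ×-dec (¬? (c ≟ᶠ d) ×-dec (baseEdge? a b c d ⊎-dec baseEdge? d c b a))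

  open Reachability (≡-dec _≟ᶠ_ _≟ᶠ_) allPairs allPairs-complete (PlusEdge H) plusEdge?
    public using (reach?)

  skew-edge : ∀ {p q} → PlusEdge H p q → PlusEdge H (swap q) (swap p)
  skew-edge (a≢b , c≢d , inj₁ base) = ≢-sym c≢d , ≢-sym a≢b , inj₂ base
  skew-edge (a≢b , c≢d , inj₂ base) = ≢-sym c≢d , ≢-sym a≢b , inj₁ base

  skew-reach : ∀ {p q} → Reach H p q → Reach H (swap q) (swap p)
  skew-reach ε        = ε
  skew-reach (e ◅ es) = skew-reach es ◅◅ (skew-edge e ◅ ε)

  lit-antisym : ∀ σ {a b} → a ≢ b → lit H σ b a ≡ not (lit H σ a b)
  lit-antisym σ {a} {b} a≢b with a <? b | b <? a
  ... | yes a<b | yes b<a = ⊥-elim (<-asym a<b b<a)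
  ... | yes _   | no _    = refl
  ... | no _    | yes _   = sym (not-involutive _)
  ... | no a≮b  | no b≮a with <-cmp a b
  ...   | tri< a<b _ _ = ⊥-elim (a≮b a<b)
  ...   | tri≈ _ a≡b _ = ⊥-elim (a≢b a≡b)
  ...   | tri> _ _ b<a = ⊥-elim (b≮a b<a)

  lit-flip-true : ∀ σ {a b} → a ≢ b → lit H σ a b ≡ true → lit H σ b a ≡ false
  lit-flip-true σ a≢b ab = trans (lit-antisym σ a≢b) (cong not ab)

  lit-flip-false : ∀ σ {a b} → a ≢ b → lit H σ a b ≡ false → lit H σ b a ≡ true
  lit-flip-false σ a≢b ab = trans (lit-antisym σ a≢b) (cong not ab)

  clause-edge : Reflexive H → ∀ {u v w} → ClauseIn H u v w → PlusEdge H (u , v) (w , v)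
  clause-edge loop {v = v} (u≢v , v≢w , _ , inj₁ (Euw , ¬Euv)) = u≢v , ≢-sym v≢w , inj₁ (Euw , loop v , ¬Euv)
  clause-edge loop {v = v} (u≢v , v≢w , _ , inj₂ (Ewu , ¬Evu)) = u≢v , ≢-sym v≢w , inj₂ (loop v , Ewu , ¬Evu)

module Soundness (H : Digraph) (loop : Reflexive H) (σ : Assignment H) (sat : Satisfies H σ) where
  open PairDigraph H

  Holds : Pair → Set
  Holds (a , b) = lit H σ a b ≡ true

  clause-left : ∀ {u v w} → ClauseIn H u v w → Holds (w , v) → Holds (u , v)
  clause-left c@(_ , v≢w , _) wv with sat _ _ _ c
  ... | inj₁ uv = uv
  ... | inj₂ vw = ⊥-elim (true≢false vw (lit-flip-true σ (≢-sym v≢w) wv))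

  clause-right : ∀ {u v w} → ClauseIn H u v w → Holds (v , u) → Holds (v , w)
  clause-right c@(u≢v , _) vu with sat _ _ _ c
  ... | inj₁ uv = ⊥-elim (true≢false uv (lit-flip-true σ (≢-sym u≢v) vu))
  ... | inj₂ vw = vw

  -- a base edge (a,b) → (c,d) is covered by the clauses (x_(a,d) ∨ x_(d,c))
  -- and (x_(d,a) ∨ x_(a,b)), which give (c,d) ⇒ (a,d) ⇒ (a,b)
  base-pullback : ∀ {a b c d} → a ≢ b → c ≢ d → BaseEdge H a b c d → Holds (c , d) → Holds (a , b)
  base-pullback {a} {b} {c} {d} a≢b c≢d (Eac , Ebd , ¬Ead) = toward-b ∘ toward-a
    where
    a≢d : a ≢ d
    a≢d refl = ¬Ead (loop a)

    toward-a : Holds (c , d) → Holds (a , d)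
    toward-a with a ≟ᶠ c
    ... | yes refl = λ ad → ad
    ... | no a≢c   = clause-left (a≢d , ≢-sym c≢d , a≢c , inj₁ (Eac , ¬Ead))

    toward-b : Holds (a , d) → Holds (a , b)
    toward-b with d ≟ᶠ b
    ... | yes refl = λ ab → ab
    ... | no d≢b   = clause-right (≢-sym a≢d , a≢b , d≢b , inj₂ (Ebd , ¬Ead))

  edge-pullback : ∀ {p q} → PlusEdge H p q → Holds q → Holds p
  edge-pullback (a≢b , c≢d , inj₁ base) cd = base-pullback a≢b c≢d base cd
  edge-pullback {a , b} (a≢b , c≢d , inj₂ base) cd with lit H σ a b in ab
  ... | true  = refl
  ... | false = ⊥-elim (true≢false
                  (base-pullback (≢-sym c≢d) (≢-sym a≢b) base (lit-flip-false σ a≢b ab))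
                  (lit-flip-true σ c≢d cd))

  reach-pullback : ∀ {p q} → Reach H p q → Holds q → Holds p
  reach-pullback ε        q = q
  reach-pullback (e ◅ es) q = edge-pullback e (reach-pullback es q)

  no-invertible-pair : ¬ HasInvertiblePair H
  no-invertible-pair (u , v , u≢v , uv⇝vu , vu⇝uv) with lit H σ u v in uv
  ... | true  = true≢false (reach-pullback vu⇝uv uv) (lit-flip-true σ u≢v uv)
  ... | false = true≢false (reach-pullback uv⇝vu (lit-flip-false σ u≢v uv)) uv

module Completeness (H : Digraph) (loop : Reflexive H) (no-inv : ¬ HasInvertiblePair H) where
  open PairDigraph H

  Closed : Subset Pair → Set
  Closed S = ∀ {p q} → Reach H p q → S q ≡ true → S p ≡ true

  Consistent : Subset Pair → Set
  Consistent S = ∀ {a b} → a ≢ b → S (a , b) ≡ true → S (b , a) ≡ true → ⊥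

  Admissible : Subset Pair → Set
  Admissible S = Closed S × Consistent S

  Decides : Subset Pair → V H → V H → Set
  Decides S a b = a ≢ b → S (a , b) ≡ true ⊎ S (b , a) ≡ true

  -- adding (a,b) and every pair reaching it keeps S admissible when (b,a) ∉ S
  -- and (b,a) does not reach (a,b); consistency uses skew-symmetry of H⁺
  extend : ∀ {S} → Admissible S → ∀ {a b} → S (b , a) ≡ false → ¬ Reach H (b , a) (a , b) →
           Σ (Subset Pair) λ S' → Admissible S' × S ⊆ S' × S' (a , b) ≡ true
  extend {S} (closed , consistent) {a} {b} ba∉S ¬ba⇝ab =
    S' , (closed' , consistent') , grows , ∨-introʳ (S (a , b)) (dec-true (reach? (a , b) (a , b)) ε)
    where
    S' : Subset Pair
    S' p = S p ∨ does (reach? p (a , b))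

    grows : S ⊆ S'
    grows p Sp = ∨-introˡ (does (reach? p (a , b))) Sp

    member : ∀ p → S' p ≡ true → S p ≡ true ⊎ Reach H p (a , b)
    member p p∈S' with ∨-true (S p) (does (reach? p (a , b))) p∈S'
    ... | inj₁ Sp = inj₁ Sp
    ... | inj₂ r  = inj₂ (does-sound (reach? p (a , b)) r)

    closed' : Closed S'
    closed' {p} {q} p⇝q q∈S' with member q q∈S'
    ... | inj₁ Sq    = grows p (closed p⇝q Sq)
    ... | inj₂ q⇝ab = ∨-introʳ (S p) (dec-true (reach? p (a , b)) (p⇝q ◅◅ q⇝ab))

    ba∈S : ∀ {p} → S p ≡ true → Reach H (b , a) p → ⊥
    ba∈S Sp ba⇝p = true≢false (closed ba⇝p Sp) ba∉S

    consistent' : Consistent S'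
    consistent' {x} {y} x≢y xy∈S' yx∈S' with member (x , y) xy∈S' | member (y , x) yx∈S'
    ... | inj₁ xy | inj₁ yx = consistent x≢y xy yx
    ... | inj₁ xy | inj₂ yx⇝ab = ba∈S xy (skew-reach yx⇝ab)
    ... | inj₂ xy⇝ab | inj₁ yx = ba∈S yx (skew-reach xy⇝ab)
    ... | inj₂ xy⇝ab | inj₂ yx⇝ab = ¬ba⇝ab (skew-reach yx⇝ab ◅◅ xy⇝ab)

  orient : ∀ {a b} → a ≢ b → ¬ Reach H (b , a) (a , b) ⊎ ¬ Reach H (a , b) (b , a)
  orient {a} {b} a≢b with reach? (b , a) (a , b)
  ... | no ¬ba⇝ab = inj₁ ¬ba⇝ab
  ... | yes ba⇝ab = inj₂ λ ab⇝ba → no-inv (a , b , a≢b , ab⇝ba , ba⇝ab)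

  Refinement : Subset Pair → V H → V H → Set
  Refinement S a b = Σ (Subset Pair) λ S' → Admissible S' × S ⊆ S' × Decides S' a b

  decide : ∀ {S} → Admissible S → ∀ a b → Refinement S a b
  decide {S} adm a b with S (a , b) in ab | S (b , a) in ba
  ... | true  | _     = S , adm , ⊆-refl , λ _ → inj₁ ab
  ... | false | true  = S , adm , ⊆-refl , λ _ → inj₂ ba
  ... | false | false with a ≟ᶠ b
  ...   | yes a≡b = S , adm , ⊆-refl , λ a≢b → ⊥-elim (a≢b a≡b)
  ...   | no a≢b with orient a≢b
  ...     | inj₁ ¬ba⇝ab with extend adm ba ¬ba⇝ab
  ...       | S' , adm' , grows , ab' = S' , adm' , grows , λ _ → inj₁ ab'
  decide adm a b | false | false | no a≢b | inj₂ ¬ab⇝ba with extend adm ab ¬ab⇝ba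
  ...       | S' , adm' , grows , ba' = S' , adm' , grows , λ _ → inj₂ ba'

  decide-all : ∀ (ps : List Pair) →
    Σ (Subset Pair) λ S → Admissible S × (∀ {a b} → (a , b) ∈ ps → Decides S a b)
  decide-all [] = (λ _ → false) , ((λ _ ()) , (λ _ ())) , λ ()
  decide-all ((a , b) ∷ ps) with decide-all ps
  ... | S , adm , decided with decide adm a b
  ...   | S' , adm' , grows , decided-ab = S' , adm' , decided'
    where
    decided' : ∀ {x y} → (x , y) ∈ (a , b) ∷ ps → Decides S' x y
    decided' (here refl) = decided-ab
    decided' (there xy∈ps) x≢y with decided xy∈ps x≢y
    ... | inj₁ xy = inj₁ (grows _ xy)
    ... | inj₂ yx = inj₂ (grows _ yx)

  S : Subset Pair
  S = proj₁ (decide-all allPairs)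

  closed : Closed S
  closed = proj₁ (proj₁ (proj₂ (decide-all allPairs)))

  consistent : Consistent S
  consistent = proj₂ (proj₁ (proj₂ (decide-all allPairs)))

  decided : ∀ a b → Decides S a b
  decided a b = proj₂ (proj₂ (decide-all allPairs)) (allPairs-complete (a , b))

  complement : ∀ {a b} → a ≢ b → S (b , a) ≡ not (S (a , b))
  complement {a} {b} a≢b with S (a , b) in ab | S (b , a) in ba
  ... | true  | true  = ⊥-elim (consistent a≢b ab ba)
  ... | true  | false = refl
  ... | false | true  = refl
  ... | false | false with decided a b a≢b
  ...   | inj₁ ab' = ⊥-elim (true≢false ab' ab)
  ...   | inj₂ ba' = ⊥-elim (true≢false ba' ba)

  σ : Assignment H
  σ a b = S (a , b)

  -- by complementarity the literal of (u,v) is membership of (u,v) in S in both orders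
  lit≡S : ∀ {u v} → u ≢ v → lit H σ u v ≡ S (u , v)
  lit≡S {u} {v} u≢v with u <? v
  ... | yes _ = refl
  ... | no _  = sym (complement (≢-sym u≢v))

  -- if x_(v,w) is false then (w,v) ∈ S, and (u,v) → (w,v) forces x_(u,v)
  satisfies : Satisfies H σ
  satisfies u v w c@(u≢v , v≢w , _) with S (v , w) in vw
  ... | true  = inj₂ (trans (lit≡S v≢w) vw)
  ... | false = inj₁ (trans (lit≡S u≢v)
                  (closed (clause-edge loop c ◅ ε) (trans (complement v≢w) (cong not vw))))

lemma5 : (H : Digraph) → Reflexive H →
    (Satisfiable H → ¬ HasInvertiblePair H) × (¬ HasInvertiblePair H → Satisfiable H)
lemma5 H loop = (λ { (σ , sat) → Soundness.no-invertible-pair H loop σ sat })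
              , (λ no-inv → Completeness.σ H loop no-inv , Completeness.satisfies H loop no-inv)
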